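{- Let $n,m\ge0$ be coprime integers and $Z$ a $1$-truncated Dieudonn\'e module over $k$. Let $(G^jZ)_{j\in\mathbb Z}$ be a descending filtration of $Z$ by subspaces such that $F(G^jZ)\subseteq G^{j+n}Z$ and $V(G^jZ)\subseteq G^{j+m}Z$ for all $j$. The following are equivalent: (i) The vector space $\operatorname{gr}Z=\bigoplus_jG^jZ/G^{j+1}Z$, with the graded maps of degree $n$ and $m$ induced by $F$ and $V$, is a graded $1$-truncated Dieudonn\'e module of type $(n,m)$. (ii) For all $j\in\mathbb Z$, $F(G^jZ)=G^{j+n}Z\cap F(Z)$ and $V(G^jZ)=G^{j+m}Z\cap V(Z)$.
   Context: $k$ is an algebraically closed field of characteristic $p>0$. A $1$-truncated Dieudonn\'e module is a finite-dimensional $k$-vector space $Z$ with $F$ linear w.r.t. $a\mapsto a^p$ and $V$ linear w.r.t. $a\mapsto a^{1/p}$ such that $\ker F=\operatorname{Im}V$ and $\operatorname{Im}F=\ker V$. A graded $1$-truncated Dieudonn\'e module of type $(n,m)$ is one with a $\mathbb Z$-grading $Z=\bigoplus Z^j$ such that $F(Z^j)\subseteq Z^{j+n}$ and $V(Z^j)\subseteq Z^{j+m}$. A descending filtration has $G^jZ\supseteq G^{j+1}Z$, $G^jZ=Z$ for $j\ll0$ and $G^jZ=0$ for $j\gg0$. -}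

module Defs where

open import Level using (Level; _⊔_) renaming (suc to lsuc)
open import Data.Nat using (ℕ; zero; suc)
open import Data.Nat.Primality using (Prime)
open import Data.Fin using (Fin)
import Data.Fin
open import Data.List using (List; []; _∷_)
open import Data.Product using (Σ; ∃; _×_; _,_)
open import Data.Integer as ℤ using (ℤ)
open import Relation.Nullary using (¬_)
open import Function.Bundles using (_⇔_)
open import Relation.Binary.PropositionalEquality using (_≡_; subst; trans; cong)
open import Data.Integer.Properties using (+-assoc; +-inverseˡ; +-identityʳ)

shift : ∀ (j d : ℤ) → (j ℤ.- d) ℤ.+ d ≡ j
shift j d = trans (+-assoc j (ℤ.- d) d) (trans (cong (λ z → j ℤ.+ z) (+-inverseˡ d)) (+-identityʳ j))
open import Algebra.Bundles using (CommutativeRing; Ring)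
open import Algebra.Module.Bundles using (LeftModule)

module _ {c ℓ : Level} (K : CommutativeRing c ℓ) where
  open CommutativeRing K

  pow : Carrier → ℕ → Carrier
  pow a zero = 1#
  pow a (suc n) = a * pow a n

  natCast : ℕ → Carrier
  natCast zero = 0#
  natCast (suc n) = 1# + natCast n

  record IsField : Set (c ⊔ ℓ) where
    field
      nontrivial : ¬ (1# ≈ 0#)
      inverse    : ∀ x → ¬ (x ≈ 0#) → ∃ λ y → x * y ≈ 1#

  HasChar : ℕ → Set ℓ
  HasChar p = natCast p ≈ 0#

  -- value at x of the monic polynomial  c₀ + c₁ x + … + c_{d-1} x^{d-1} + x^d
  -- where d is the length of the coefficient list
  evalMonic : List Carrier → Carrier → Carrier
  evalMonic [] x = 1#
  evalMonic (a ∷ as) x = a + x * evalMonic as x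

  AlgClosed : Set (c ⊔ ℓ)
  AlgClosed = ∀ (a : Carrier) (as : List Carrier) → ∃ λ x → evalMonic (a ∷ as) x ≈ 0#

module _ {c ℓ m ℓm : Level} (K : CommutativeRing c ℓ)
         (Z : LeftModule (CommutativeRing.ring K) m ℓm) where
  open CommutativeRing K
  open LeftModule Z

  sumFin : (d : ℕ) → (Fin d → Carrierᴹ) → Carrierᴹ
  sumFin zero f = 0ᴹ
  sumFin (suc d) f = f Data.Fin.zero +ᴹ sumFin d (λ i → f (Data.Fin.suc i))

  FiniteDimensional : Set (c ⊔ m ⊔ ℓm)
  FiniteDimensional =
    Σ ℕ λ d → Σ (Fin d → Carrierᴹ) λ b →
      ∀ x → ∃ λ (a : Fin d → Carrier) → x ≈ᴹ sumFin d (λ i → a i *ₗ b i)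

  record Subspace (ℓs : Level) : Set (c ⊔ m ⊔ ℓm ⊔ lsuc ℓs) where
    field
      mem     : Carrierᴹ → Set ℓs
      ∈-resp  : ∀ {x y} → x ≈ᴹ y → mem x → mem y
      0∈      : mem 0ᴹ
      +∈      : ∀ {x y} → mem x → mem y → mem (x +ᴹ y)
      *∈      : ∀ a {x} → mem x → mem (a *ₗ x)
  open Subspace public

  record IsSemilinear (σ : Carrier → Carrier) (f : Carrierᴹ → Carrierᴹ) : Set (c ⊔ m ⊔ ℓm) where
    field
      f-cong : ∀ {x y} → x ≈ᴹ y → f x ≈ᴹ f y
      f-+    : ∀ x y → f (x +ᴹ y) ≈ᴹ f x +ᴹ f y
      f-*    : ∀ a x → f (a *ₗ x) ≈ᴹ σ a *ₗ f x

  -- V is linear w.r.t. a ↦ a^(1/p): written as V (a^p x) = a V x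
  -- (equivalent, since Frobenius is bijective on a perfect field)
  record IsInvFrobSemilinear (p : ℕ) (f : Carrierᴹ → Carrierᴹ) : Set (c ⊔ m ⊔ ℓm) where
    field
      f-cong : ∀ {x y} → x ≈ᴹ y → f x ≈ᴹ f y
      f-+    : ∀ x y → f (x +ᴹ y) ≈ᴹ f x +ᴹ f y
      f-*    : ∀ a x → f (pow K a p *ₗ x) ≈ᴹ a *ₗ f x

  record IsDieudonne1 (p : ℕ) (F V : Carrierᴹ → Carrierᴹ) : Set (c ⊔ m ⊔ ℓm) where
    field
      finDim  : FiniteDimensional
      F-semi  : IsSemilinear (λ a → pow K a p) F
      V-semi  : IsInvFrobSemilinear p V
      kerF=ImV : ∀ x → (F x ≈ᴹ 0ᴹ) ⇔ (∃ λ y → x ≈ᴹ V y)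
      ImF=kerV : ∀ x → (∃ λ y → x ≈ᴹ F y) ⇔ (V x ≈ᴹ 0ᴹ)

  record IsDescFiltration {ℓs} (G : ℤ → Subspace ℓs) : Set (m ⊔ ℓm ⊔ ℓs) where
    field
      descending : ∀ j x → mem (G (j ℤ.+ ℤ.1ℤ)) x → mem (G j) x
      exhaustive : ∃ λ a → ∀ j → j ℤ.≤ a → ∀ x → mem (G j) x
      separated  : ∃ λ b → ∀ j → b ℤ.≤ j → ∀ x → mem (G j) x → x ≈ᴹ 0ᴹ

  module _ {ℓs} (G : ℤ → Subspace ℓs) (n m' : ℕ) (F V : Carrierᴹ → Carrierᴹ) where

    -- Since the filtration is bounded, an element of
    -- gr Z is represented by a family x : ℤ → Z with x j ∈ G^j (for j ≪ 0 the
    -- component is 0 in G^j/G^{j+1} = 0, for j ≫ 0 it is 0), and two families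
    -- represent the same element iff x j - y j ∈ G^{j+1} for all j.
    GrElt : Set (m ⊔ ℓs)
    GrElt = Σ (ℤ → Carrierᴹ) λ x → ∀ j → mem (G j) (x j)

    _≈gr_ : GrElt → GrElt → Set ℓs
    (x , _) ≈gr (y , _) = ∀ j → mem (G (j ℤ.+ ℤ.1ℤ)) (x j +ᴹ (-ᴹ y j))

    0gr : GrElt
    0gr = (λ _ → 0ᴹ) , (λ j → 0∈ (G j))

    module _ (Fcomp : ∀ j x → mem (G j) x → mem (G (j ℤ.+ ℤ.+ n)) (F x))
             (Vcomp : ∀ j x → mem (G j) x → mem (G (j ℤ.+ ℤ.+ m')) (V x)) where

      grF : GrElt → GrElt
      grF (x , x∈) = (λ j → F (x (j ℤ.- ℤ.+ n))) ,
                     (λ j → subst (λ i → mem (G i) (F (x (j ℤ.- ℤ.+ n))))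
                                  (shift j (ℤ.+ n))
                                  (Fcomp (j ℤ.- ℤ.+ n) (x (j ℤ.- ℤ.+ n)) (x∈ (j ℤ.- ℤ.+ n))))

      grV : GrElt → GrElt
      grV (x , x∈) = (λ j → V (x (j ℤ.- ℤ.+ m'))) ,
                     (λ j → subst (λ i → mem (G i) (V (x (j ℤ.- ℤ.+ m'))))
                                  (shift j (ℤ.+ m'))
                                  (Vcomp (j ℤ.- ℤ.+ m') (x (j ℤ.- ℤ.+ m')) (x∈ (j ℤ.- ℤ.+ m'))))

      -- gr Z with the induced graded maps is a (graded, of type (n,m'))
      -- 1-truncated Dieudonné module: ker F̄ = Im V̄ and Im F̄ = ker V̄.
      -- (Finite dimensionality, semilinearity and the grading of type (n,m')
      -- hold automatically by construction.)
      GrIsDieudonne : Set (m ⊔ ℓs)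
      GrIsDieudonne =
        (∀ x → (grF x ≈gr 0gr) ⇔ (∃ λ y → x ≈gr grV y)) ×
        (∀ x → (∃ λ y → x ≈gr grF y) ⇔ (grV x ≈gr 0gr))

    StrictCompat : Set (m ⊔ ℓm ⊔ ℓs)
    StrictCompat = ∀ (j : ℤ) →
      (∀ y → (∃ λ x → mem (G j) x × y ≈ᴹ F x)
             ⇔ (mem (G (j ℤ.+ ℤ.+ n)) y × ∃ λ x → y ≈ᴹ F x)) ×
      (∀ y → (∃ λ x → mem (G j) x × y ≈ᴹ V x)
             ⇔ (mem (G (j ℤ.+ ℤ.+ m')) y × ∃ λ x → y ≈ᴹ V x))

module Submission where

-- Let A, B be additive maps of Z with  A ∘ B = 0  and
-- ker A ⊆ Im B, A compatible with the filtration in degree α, B read in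
-- degree β.  Then  Im(gr B) ⊆ ker(gr A)  holds for free, and the reverse
-- inclusion is equivalent to the pointwise statement HomogeneousExact: every
-- x ∈ G^k with A x ∈ G^{k+α+1} is congruent modulo G^{k+1} to some B y with
-- y ∈ G^{k-β} (test it on the element of gr Z concentrated in degree k).
-- HomogeneousExact implies strictness of A,  A(G^j) = G^{j+α} ∩ Im A : start
-- from a preimage in G^a = Z (a as in exhaustiveness) and raise its filtration
-- degree one step at a time, correcting by elements of Im B ⊆ ker A.
-- Conversely strictness of both A and B gives HomogeneousExact directly.

open import Defs
open import Level using (Level; _⊔_)
open import Data.Nat using (ℕ)
open import Data.Nat.Primality using (Prime)
open import Data.Nat.Coprimality using (Coprime)
open import Data.Integer as ℤ using (ℤ)
open import Function.Bundles using (_⇔_)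
open import Algebra.Bundles using (CommutativeRing)
open import Algebra.Module.Bundles using (LeftModule)

import Data.Nat as ℕ
open import Data.Product using (∃; _×_; _,_; proj₁; proj₂)
open import Data.Empty using (⊥-elim)
open import Function.Bundles using (Equivalence; mk⇔)
open import Relation.Nullary using (Dec; yes; no)
open import Relation.Binary.PropositionalEquality using (_≡_; refl; sym; trans; cong; subst)
import Data.Integer.Properties as ℤP
open import Data.Integer.Tactic.RingSolver using (solve-∀)
import Algebra.Properties.AbelianGroup as AbelianGroupProperties
import Relation.Binary.Reasoning.Setoid as SetoidReasoning

module FilteredExactness {c ℓ a ℓa ℓs : Level} (K : CommutativeRing c ℓ)
  (Z : LeftModule (CommutativeRing.ring K) a ℓa) (G : ℤ → Subspace K Z ℓs)
  (filtration : IsDescFiltration K Z G) where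
  open LeftModule Z
  open CommutativeRing K using (1#; 0#) renaming (-_ to -ᵏ_; _+_ to _+ᵏ_; -‿inverseʳ to -ᵏ‿inverseʳ)
  open AbelianGroupProperties +ᴹ-abelianGroup
  open SetoidReasoning ≈ᴹ-setoid
  open IsDescFiltration filtration

  M : Set a
  M = Carrierᴹ

  _-ᴹ_ : M → M → M
  x -ᴹ y = x +ᴹ (-ᴹ y)

  _∈G_ : M → ℤ → Set ℓs
  x ∈G i = mem (G i) x

  reindex : ∀ {i j x} → i ≡ j → x ∈G i → x ∈G j
  reindex {x = x} i≡j x∈ = subst (x ∈G_) i≡j x∈

  ∈G-resp : ∀ {i x y} → x ≈ᴹ y → x ∈G i → y ∈G i
  ∈G-resp {i} = ∈-resp (G i)

  -‿1-scales-to-neg : ∀ x → ((-ᵏ 1#) *ₗ x) ≈ᴹ (-ᴹ x)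
  -‿1-scales-to-neg x = inverseʳ-unique x ((-ᵏ 1#) *ₗ x) (begin
      x +ᴹ ((-ᵏ 1#) *ₗ x)          ≈⟨ +ᴹ-congʳ (≈ᴹ-sym (*ₗ-identityˡ x)) ⟩
      (1# *ₗ x) +ᴹ ((-ᵏ 1#) *ₗ x) ≈⟨ ≈ᴹ-sym (*ₗ-distribʳ x 1# (-ᵏ 1#)) ⟩
      (1# +ᵏ (-ᵏ 1#)) *ₗ x          ≈⟨ *ₗ-congʳ (-ᵏ‿inverseʳ 1#) ⟩
      0# *ₗ x                       ≈⟨ *ₗ-zeroˡ x ⟩
      0ᴹ ∎)

  -- Each G^i is closed under subtraction (subspaces only provide scaling).
  sub-∈G : ∀ {i x y} → x ∈G i → y ∈G i → (x -ᴹ y) ∈G i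
  sub-∈G {i} {y = y} x∈ y∈ = +∈ (G i) x∈ (∈G-resp (-‿1-scales-to-neg y) (*∈ (G i) (-ᵏ 1#) y∈))

  sub-0 : ∀ x → (x -ᴹ 0ᴹ) ≈ᴹ x
  sub-0 x = ≈ᴹ-trans (+ᴹ-congˡ ε⁻¹≈ε) (+ᴹ-identityʳ x)

  sub-sub : ∀ x y → (x -ᴹ (x -ᴹ y)) ≈ᴹ y
  sub-sub x y = begin
    x +ᴹ (-ᴹ (x +ᴹ -ᴹ y))     ≈⟨ +ᴹ-congˡ (≈ᴹ-sym (⁻¹-∙-comm x (-ᴹ y))) ⟩
    x +ᴹ ((-ᴹ x) +ᴹ -ᴹ -ᴹ y)  ≈⟨ ≈ᴹ-sym (+ᴹ-assoc x (-ᴹ x) (-ᴹ -ᴹ y)) ⟩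
    (x +ᴹ -ᴹ x) +ᴹ -ᴹ -ᴹ y   ≈⟨ +ᴹ-cong (-ᴹ‿inverseʳ x) (⁻¹-involutive y) ⟩
    0ᴹ +ᴹ y                  ≈⟨ +ᴹ-identityˡ y ⟩
    y ∎

  module AdditiveMap (f : M → M) (f-cong : ∀ {x y} → x ≈ᴹ y → f x ≈ᴹ f y)
                     (f-+ : ∀ x y → f (x +ᴹ y) ≈ᴹ f x +ᴹ f y) where
    f-0 : f 0ᴹ ≈ᴹ 0ᴹ
    f-0 = identityʳ-unique (f 0ᴹ) (f 0ᴹ)
            (≈ᴹ-trans (≈ᴹ-sym (f-+ 0ᴹ 0ᴹ)) (f-cong (+ᴹ-identityʳ 0ᴹ)))

    f-neg : ∀ x → f (-ᴹ x) ≈ᴹ -ᴹ f x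
    f-neg x = inverseʳ-unique (f x) (f (-ᴹ x))
      (≈ᴹ-trans (≈ᴹ-sym (f-+ x (-ᴹ x))) (≈ᴹ-trans (f-cong (-ᴹ‿inverseʳ x)) f-0))

    f-sub : ∀ x y → f (x -ᴹ y) ≈ᴹ f x -ᴹ f y
    f-sub x y = ≈ᴹ-trans (f-+ x (-ᴹ y)) (+ᴹ-congˡ (f-neg y))

  antitone : ∀ d i {x} → x ∈G (i ℤ.+ ℤ.+ d) → x ∈G i
  antitone ℕ.zero i x∈ = reindex (ℤP.+-identityʳ i) x∈
  antitone (ℕ.suc d) i {x} x∈ =
    antitone d i (descending (i ℤ.+ ℤ.+ d) x (reindex (index-eq i d) x∈))
    where
    index-eq : ∀ i d → i ℤ.+ ℤ.+ ℕ.suc d ≡ (i ℤ.+ ℤ.+ d) ℤ.+ ℤ.1ℤ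
    index-eq i d = trans (cong (λ t → i ℤ.+ t) (ℤP.pos-+ 1 d)) (shuffle i (ℤ.+ d))
      where
      shuffle : ∀ (i e : ℤ) → i ℤ.+ (ℤ.1ℤ ℤ.+ e) ≡ (i ℤ.+ e) ℤ.+ ℤ.1ℤ
      shuffle = solve-∀

  ≤⇒+ℕ : ∀ {i j} → i ℤ.≤ j → ∃ λ d → i ℤ.+ ℤ.+ d ≡ j
  ≤⇒+ℕ {i} {j} i≤j =
    ℤ.∣ j ℤ.- i ∣ , trans (cong (λ t → i ℤ.+ t) (ℤP.0≤i⇒+∣i∣≡i (ℤP.i≤j⇒0≤j-i i≤j))) (cancel i j)
    where
    cancel : ∀ (i j : ℤ) → i ℤ.+ (j ℤ.- i) ≡ j
    cancel = solve-∀

  Compatible : (M → M) → ℕ → Set (a ⊔ ℓs)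
  Compatible f d = ∀ j x → x ∈G j → f x ∈G (j ℤ.+ ℤ.+ d)

  StrictImage : (M → M) → ℕ → Set (a ⊔ ℓa ⊔ ℓs)
  StrictImage f d = ∀ j y → y ∈G (j ℤ.+ ℤ.+ d) → (∃ λ x → y ≈ᴹ f x) →
                    ∃ λ x → x ∈G j × y ≈ᴹ f x

  strict : ∀ {f d} → Compatible f d → StrictImage f d → ∀ j y →
           (∃ λ x → x ∈G j × y ≈ᴹ f x) ⇔ (y ∈G (j ℤ.+ ℤ.+ d) × ∃ λ x → y ≈ᴹ f x)
  strict f-comp f-strict j y = mk⇔
    (λ { (x , x∈ , y≈fx) → ∈G-resp (≈ᴹ-sym y≈fx) (f-comp j x x∈) , (x , y≈fx) })
    (λ { (y∈ , y∈Im) → f-strict j y y∈ y∈Im })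

  Gr : Set (a ⊔ ℓs)
  Gr = ∃ λ (x : ℤ → M) → ∀ j → x j ∈G j

  module Concentrated (k : ℤ) (x : M) (x∈ : x ∈G k) where
    component : ∀ {i} → Dec (i ≡ k) → M
    component (yes _) = x
    component (no _)  = 0ᴹ

    component∈ : ∀ {i} (i≟k : Dec (i ≡ k)) → component i≟k ∈G i
    component∈ (yes i≡k) = reindex (sym i≡k) x∈
    component∈ {i} (no _) = 0∈ (G i)

    component-at-k : (k≟k : Dec (k ≡ k)) → component k≟k ≡ x
    component-at-k (yes _)  = refl
    component-at-k (no k≢k) = ⊥-elim (k≢k refl)

    concentrated : Gr
    concentrated = (λ i → component (i ℤ.≟ k)) , (λ i → component∈ (i ℤ.≟ k))

  module ExactPair (A B : M → M) (α β : ℕ)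
     (A-cong : ∀ {x y} → x ≈ᴹ y → A x ≈ᴹ A y) (A-+ : ∀ x y → A (x +ᴹ y) ≈ᴹ A x +ᴹ A y)
     (kerA⊆ImB : ∀ x → A x ≈ᴹ 0ᴹ → ∃ λ y → x ≈ᴹ B y)
     (A∘B≈0 : ∀ y → A (B y) ≈ᴹ 0ᴹ)
     (A-comp : Compatible A α) where
    open AdditiveMap A A-cong A-+

    -- x ∈ ker(gr A), literally the relation  gr A x ≈gr 0  of Defs.
    GrKer : Gr → Set ℓs
    GrKer x = ∀ j → (A (proj₁ x (j ℤ.- ℤ.+ α)) -ᴹ 0ᴹ) ∈G (j ℤ.+ ℤ.1ℤ)

    -- x ∈ Im(gr B), literally  ∃ y. x ≈gr gr B y.
    GrIm : Gr → Set (a ⊔ ℓs)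
    GrIm x = ∃ λ (y : Gr) → ∀ j → (proj₁ x j -ᴹ B (proj₁ y (j ℤ.- ℤ.+ β))) ∈G (j ℤ.+ ℤ.1ℤ)

    -- Exactness of  gr B, gr A  in each single degree k, stated in Z.
    HomogeneousExact : Set (a ⊔ ℓs)
    HomogeneousExact = ∀ k x → x ∈G k → A x ∈G ((k ℤ.+ ℤ.+ α) ℤ.+ ℤ.1ℤ) →
      ∃ λ y → y ∈G (k ℤ.- ℤ.+ β) × (x -ᴹ B y) ∈G (k ℤ.+ ℤ.1ℤ)

    A-sub-B : ∀ x y → A (x -ᴹ B y) ≈ᴹ A x
    A-sub-B x y = begin
      A (x -ᴹ B y)    ≈⟨ f-sub x (B y) ⟩
      A x -ᴹ A (B y)  ≈⟨ +ᴹ-congˡ (-ᴹ‿cong (A∘B≈0 y)) ⟩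
      A x -ᴹ 0ᴹ       ≈⟨ sub-0 (A x) ⟩
      A x ∎

    grIm⊆grKer : ∀ x → GrIm x → GrKer x
    grIm⊆grKer x (y , x≈By) j =
      reindex (index-eq j (ℤ.+ α))
        (∈G-resp (≈ᴹ-trans (A-sub-B (proj₁ x i) (proj₁ y (i ℤ.- ℤ.+ β))) (≈ᴹ-sym (sub-0 _)))
          (A-comp (i ℤ.+ ℤ.1ℤ) _ (x≈By i)))
      where
      i : ℤ
      i = j ℤ.- ℤ.+ α
      index-eq : ∀ (j e : ℤ) → ((j ℤ.- e) ℤ.+ ℤ.1ℤ) ℤ.+ e ≡ j ℤ.+ ℤ.1ℤ
      index-eq = solve-∀

    homogeneousExact⇒grKer⊆grIm : HomogeneousExact → ∀ x → GrKer x → GrIm x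
    homogeneousExact⇒grKer⊆grIm exact x x∈ker = (y , y∈) , x≈By
      where
      unshift : ∀ (i e : ℤ) → (i ℤ.+ e) ℤ.- e ≡ i
      unshift = solve-∀
      killed : ∀ i → A (proj₁ x (i ℤ.+ ℤ.+ β)) ∈G (((i ℤ.+ ℤ.+ β) ℤ.+ ℤ.+ α) ℤ.+ ℤ.1ℤ)
      killed i = ∈G-resp (sub-0 _)
        (subst (λ t → (A (proj₁ x t) -ᴹ 0ᴹ) ∈G (((i ℤ.+ ℤ.+ β) ℤ.+ ℤ.+ α) ℤ.+ ℤ.1ℤ))
          (unshift (i ℤ.+ ℤ.+ β) (ℤ.+ α)) (x∈ker ((i ℤ.+ ℤ.+ β) ℤ.+ ℤ.+ α)))
      preimage : ∀ i → ∃ λ y → y ∈G ((i ℤ.+ ℤ.+ β) ℤ.- ℤ.+ β) ×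
                       (proj₁ x (i ℤ.+ ℤ.+ β) -ᴹ B y) ∈G ((i ℤ.+ ℤ.+ β) ℤ.+ ℤ.1ℤ)
      preimage i = exact (i ℤ.+ ℤ.+ β) (proj₁ x (i ℤ.+ ℤ.+ β)) (proj₂ x (i ℤ.+ ℤ.+ β)) (killed i)
      y : ℤ → M
      y i = proj₁ (preimage i)
      y∈ : ∀ i → y i ∈G i
      y∈ i = reindex (unshift i (ℤ.+ β)) (proj₁ (proj₂ (preimage i)))
      x≈By : ∀ j → (proj₁ x j -ᴹ B (y (j ℤ.- ℤ.+ β))) ∈G (j ℤ.+ ℤ.1ℤ)
      x≈By j = subst (λ t → (proj₁ x t -ᴹ B (y (j ℤ.- ℤ.+ β))) ∈G (t ℤ.+ ℤ.1ℤ))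
                 (shift j (ℤ.+ β)) (proj₂ (proj₂ (preimage (j ℤ.- ℤ.+ β))))

    -- Conversely, testing ker(gr A) ⊆ Im(gr B) on the element concentrated in
    -- degree k gives homogeneous exactness in degree k.
    grKer⊆grIm⇒homogeneousExact : (∀ x → GrKer x → GrIm x) → HomogeneousExact
    grKer⊆grIm⇒homogeneousExact grKer⊆grIm k x x∈ Ax∈ =
      proj₁ y (k ℤ.- ℤ.+ β) , proj₂ y (k ℤ.- ℤ.+ β) ,
      subst (λ t → (t -ᴹ B (proj₁ y (k ℤ.- ℤ.+ β))) ∈G (k ℤ.+ ℤ.1ℤ))
        (component-at-k (k ℤ.≟ k)) (x≈By k)
      where
      open Concentrated k x x∈
      killed : ∀ j (j-α≟k : Dec (j ℤ.- ℤ.+ α ≡ k)) → (A (component j-α≟k) -ᴹ 0ᴹ) ∈G (j ℤ.+ ℤ.1ℤ)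
      killed j (yes j-α≡k) = ∈G-resp (≈ᴹ-sym (sub-0 _))
        (reindex (trans (cong (λ t → (t ℤ.+ ℤ.+ α) ℤ.+ ℤ.1ℤ) (sym j-α≡k))
                        (cong (ℤ._+ ℤ.1ℤ) (shift j (ℤ.+ α)))) Ax∈)
      killed j (no _) = ∈G-resp (≈ᴹ-sym (≈ᴹ-trans (sub-0 _) f-0)) (0∈ (G (j ℤ.+ ℤ.1ℤ)))
      y∈Im : GrIm concentrated
      y∈Im = grKer⊆grIm concentrated (λ j → killed j ((j ℤ.- ℤ.+ α) ℤ.≟ k))
      y : Gr
      y = proj₁ y∈Im
      x≈By : ∀ j → (proj₁ concentrated j -ᴹ B (proj₁ y (j ℤ.- ℤ.+ β))) ∈G (j ℤ.+ ℤ.1ℤ)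
      x≈By = proj₂ y∈Im

    raise-step : HomogeneousExact → ∀ i x → x ∈G i → A x ∈G ((i ℤ.+ ℤ.+ α) ℤ.+ ℤ.1ℤ) →
                 ∃ λ x' → x' ∈G (i ℤ.+ ℤ.1ℤ) × A x ≈ᴹ A x'
    raise-step exact i x x∈ Ax∈ =
      let (y , _ , x-By∈) = exact i x x∈ Ax∈
      in x -ᴹ B y , x-By∈ , ≈ᴹ-sym (A-sub-B x y)

    raise : HomogeneousExact → ∀ d i x → x ∈G i → A x ∈G ((i ℤ.+ ℤ.+ d) ℤ.+ ℤ.+ α) →
            ∃ λ x' → x' ∈G (i ℤ.+ ℤ.+ d) × A x ≈ᴹ A x'
    raise exact ℕ.zero i x x∈ _ = x , reindex (sym (ℤP.+-identityʳ i)) x∈ , ≈ᴹ-refl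
    raise exact (ℕ.suc d) i x x∈ Ax∈ =
      let (x' , x'∈ , Ax≈Ax') = raise-step exact i x x∈
                                  (antitone d _ (reindex (sym deeper) Ax∈))
          (x'' , x''∈ , Ax'≈Ax'') = raise exact d (i ℤ.+ ℤ.1ℤ) x' x'∈
                                  (∈G-resp Ax≈Ax' (reindex (cong (ℤ._+ ℤ.+ α) split) Ax∈))
      in x'' , reindex (sym split) x''∈ , ≈ᴹ-trans Ax≈Ax' Ax'≈Ax''
      where
      regroup : ∀ (i e : ℤ) → i ℤ.+ (ℤ.1ℤ ℤ.+ e) ≡ (i ℤ.+ ℤ.1ℤ) ℤ.+ e
      regroup = solve-∀
      split : i ℤ.+ ℤ.+ ℕ.suc d ≡ (i ℤ.+ ℤ.1ℤ) ℤ.+ ℤ.+ d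
      split = trans (cong (λ t → i ℤ.+ t) (ℤP.pos-+ 1 d)) (regroup i (ℤ.+ d))
      commute : ∀ (i a e : ℤ) → ((i ℤ.+ a) ℤ.+ ℤ.1ℤ) ℤ.+ e ≡ ((i ℤ.+ ℤ.1ℤ) ℤ.+ e) ℤ.+ a
      commute = solve-∀
      deeper : ((i ℤ.+ ℤ.+ α) ℤ.+ ℤ.1ℤ) ℤ.+ ℤ.+ d ≡ (i ℤ.+ ℤ.+ ℕ.suc d) ℤ.+ ℤ.+ α
      deeper = trans (commute i (ℤ.+ α) (ℤ.+ d)) (cong (ℤ._+ ℤ.+ α) (sym split))

    -- Homogeneous exactness makes A strict: raise a preimage from G^{j ⊓ a},
    -- which is all of Z by exhaustiveness, up to G^j.
    homogeneousExact⇒strictImage : HomogeneousExact → StrictImage A α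
    homogeneousExact⇒strictImage exact j y y∈ (x , y≈Ax) =
      let (a₀ , exhausts) = exhaustive
          i : ℤ
          i = j ℤ.⊓ a₀
          (d , i+d≡j) = ≤⇒+ℕ (ℤP.i⊓j≤i j a₀)
          (x' , x'∈ , Ax≈Ax') = raise exact d i x (exhausts i (ℤP.i⊓j≤j j a₀) x)
                                  (reindex (cong (ℤ._+ ℤ.+ α) (sym i+d≡j)) (∈G-resp y≈Ax y∈))
      in x' , reindex i+d≡j x'∈ , ≈ᴹ-trans y≈Ax Ax≈Ax'

    -- Strictness of A and B gives homogeneous exactness: replace x by x' ∈ G^{k+1}
    -- with A x = A x'; then x - x' = B y, and B y can be taken from B(G^{k-β}).
    strictImages⇒homogeneousExact : StrictImage A α → StrictImage B β → HomogeneousExact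
    strictImages⇒homogeneousExact A-strict B-strict k x x∈ Ax∈ =
      let (x' , x'∈ , Ax≈Ax') = A-strict (k ℤ.+ ℤ.1ℤ) (A x) (reindex (commute k (ℤ.+ α)) Ax∈)
                                  (x , ≈ᴹ-refl)
          (y , x-x'≈By) = kerA⊆ImB (x -ᴹ x')
                            (≈ᴹ-trans (f-sub x x') (x≈y⇒x∙y⁻¹≈ε Ax≈Ax'))
          By∈ : B y ∈G k
          By∈ = ∈G-resp x-x'≈By (sub-∈G x∈ (descending k x' x'∈))
          (y' , y'∈ , By≈By') = B-strict (k ℤ.- ℤ.+ β) (B y)
                                  (reindex (sym (shift k (ℤ.+ β))) By∈) (y , ≈ᴹ-refl)
      in y' , y'∈ , ∈G-resp (≈ᴹ-sym (begin
           x -ᴹ B y'       ≈⟨ +ᴹ-congˡ (-ᴹ‿cong (≈ᴹ-sym By≈By')) ⟩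
           x -ᴹ B y        ≈⟨ +ᴹ-congˡ (-ᴹ‿cong (≈ᴹ-sym x-x'≈By)) ⟩
           x -ᴹ (x -ᴹ x')  ≈⟨ sub-sub x x' ⟩
           x' ∎)) x'∈
      where
      commute : ∀ (k a : ℤ) → (k ℤ.+ a) ℤ.+ ℤ.1ℤ ≡ (k ℤ.+ ℤ.1ℤ) ℤ.+ a
      commute = solve-∀

-- Lemma 4.1: both (i) and (ii) amount to homogeneous exactness of the
-- exact pairs (F, V) and (V, F).
lemma4p1 : ∀ {c ℓ a ℓa ℓs : Level}
    (K : CommutativeRing c ℓ) → IsField K → AlgClosed K →
    (p : ℕ) → Prime p → HasChar K p →
    (Z : LeftModule (CommutativeRing.ring K) a ℓa) →
    (F V : LeftModule.Carrierᴹ Z → LeftModule.Carrierᴹ Z) →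
    IsDieudonne1 K Z p F V →
    (n m : ℕ) → Coprime n m →
    (G : ℤ → Subspace K Z ℓs) → IsDescFiltration K Z G →
    (Fcomp : ∀ j x → mem (G j) x → mem (G (j ℤ.+ ℤ.+ n)) (F x)) →
    (Vcomp : ∀ j x → mem (G j) x → mem (G (j ℤ.+ ℤ.+ m)) (V x)) →
    GrIsDieudonne K Z G n m F V Fcomp Vcomp ⇔ StrictCompat K Z G n m F V
lemma4p1 K _ _ p _ _ Z F V dieudonne n m _ G filtration Fcomp Vcomp = mk⇔ gr⇒strict strict⇒gr
  where
  open LeftModule Z using (≈ᴹ-refl)
  open FilteredExactness K Z G filtration
  open IsDieudonne1 dieudonne
  open Equivalence using (to; from)
  module F = IsSemilinear F-semi
  module V = IsInvFrobSemilinear V-semi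
  module FV = ExactPair F V n m F.f-cong F.f-+ (λ x → to (kerF=ImV x))
                (λ y → from (kerF=ImV (V y)) (y , ≈ᴹ-refl)) Fcomp
  module VF = ExactPair V F m n V.f-cong V.f-+ (λ x → from (ImF=kerV x))
                (λ y → to (ImF=kerV (F y)) (y , ≈ᴹ-refl)) Vcomp

  gr⇒strict : GrIsDieudonne K Z G n m F V Fcomp Vcomp → StrictCompat K Z G n m F V
  gr⇒strict (kerF̄=ImV̄ , ImF̄=kerV̄) j =
    strict Fcomp (FV.homogeneousExact⇒strictImage exactFV) j ,
    strict Vcomp (VF.homogeneousExact⇒strictImage exactVF) j
    where
    exactFV : FV.HomogeneousExact
    exactFV = FV.grKer⊆grIm⇒homogeneousExact (λ x → to (kerF̄=ImV̄ x))
    exactVF : VF.HomogeneousExact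
    exactVF = VF.grKer⊆grIm⇒homogeneousExact (λ x → from (ImF̄=kerV̄ x))

  strict⇒gr : StrictCompat K Z G n m F V → GrIsDieudonne K Z G n m F V Fcomp Vcomp
  strict⇒gr strictFV =
    (λ x → mk⇔ (FV.homogeneousExact⇒grKer⊆grIm exactFV x) (FV.grIm⊆grKer x)) ,
    (λ x → mk⇔ (VF.grIm⊆grKer x) (VF.homogeneousExact⇒grKer⊆grIm exactVF x))
    where
    F-strict : StrictImage F n
    F-strict j y y∈ y∈ImF = from (proj₁ (strictFV j) y) (y∈ , y∈ImF)
    V-strict : StrictImage V m
    V-strict j y y∈ y∈ImV = from (proj₂ (strictFV j) y) (y∈ , y∈ImV)
    exactFV : FV.HomogeneousExact
    exactFV = FV.strictImages⇒homogeneousExact F-strict V-strict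
    exactVF : VF.HomogeneousExact
    exactVF = VF.strictImages⇒homogeneousExact V-strict F-strict
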